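{- In $\mathsf{CNOT}$, $\Delta_n\nabla_n=1_n$ for every $n\in\mathbb{N}$, where $\nabla_n:=\Delta_n^\circ$.
   Context: $\mathsf{CNOT}$ is the strict symmetric monoidal category with objects the natural numbers ($n\otimes m=n+m$) generated by $\mathsf{cnot}:2\to2$, $|1\rangle:0\to1$, $\langle1|:1\to0$ (and symmetry $\sigma$) modulo exactly the following identities (diagrammatic composition; $C_{i\to j}$ the cnot with control wire $i$, target wire $j$; $\mathsf{cnot}=C_{1\to2}$): $C_{1\to2}C_{2\to1}C_{1\to2}=\sigma$; $C_{1\to2}C_{1\to2}=1_2$; $C_{2\to1}C_{2\to3}=C_{2\to3}C_{2\to1}$; $(|1\rangle\otimes1)C_{1\to2}=(|1\rangle\otimes1)C_{1\to2}(\langle1|\otimes1)(|1\rangle\otimes1)$ and $C_{1\to2}(\langle1|\otimes1)=(\langle1|\otimes1)(|1\rangle\otimes1)C_{1\to2}(\langle1|\otimes1)$; $C_{1\to2}C_{3\to2}=C_{3\to2}C_{1\to2}$; $|1\rangle\langle1|=1_0$; $(|1\rangle\otimes|1\rangle\otimes1)C_{1\to2}C_{2\to3}(\langle1|\otimes1_2)=(|1\rangle\otimes|1\rangle\otimes1)C_{1\to2}(\langle1|\otimes1_2)$ and $(|1\rangle\otimes1_2)C_{2\to3}C_{1\to2}(\langle1|\otimes\langle1|\otimes1)=(|1\rangle\otimes1_2)C_{1\to2}(\langle1|\otimes\langle1|\otimes1)$; $C_{1\to2}C_{2\to3}C_{1\to2}=C_{2\to3}C_{1\to3}$; $(|1\rangle\otimes|1\rangle\otimes1)C_{1\to2}(\langle1|\otimes\langle1|\otimes1)=(|1\rangle\otimes|1\rangle\otimes\langle1|)C_{1\to2}(\langle1|\otimes\langle1|\otimes|1\rangle)$.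 The horizontal flip $(-)^\circ:\mathsf{CNOT}^{op}\to\mathsf{CNOT}$ is the identity-on-objects monoidal functor fixing $\mathsf{cnot}$ and $\sigma$ and exchanging $|1\rangle$ and $\langle1|$. Let $|0\rangle:=(|1\rangle\otimes|1\rangle)C_{1\to2}(\langle1|\otimes1_1)$. $\Delta_0:=1_0$, $\Delta_1:=(|0\rangle\otimes1_1)C_{2\to1}:1\to2$, and for $n>1$, $\Delta_n:=(\Delta_{n-1}\otimes\Delta_1)(1_{n-1}\otimes s\otimes1_1)$ with $s:(n-1)+1\to1+(n-1)$ the symmetry. -}

module Defs where

open import Data.Nat using (ℕ; zero; suc; _+_)
open import Data.Nat.Properties using (+-assoc; +-comm; +-suc)
open import Relation.Binary.PropositionalEquality
  using (_≡_; refl; sym; trans; cong; subst; subst₂)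

infixl 6 _⨾_
infixl 7 _⊗_

-- Syntax of string diagrams for the strict symmetric monoidal category
-- freely generated (objects = ℕ, n ⊗ m = n + m) by
--   cnot : 2 → 2,  |1⟩ : 0 → 1,  ⟨1| : 1 → 0,
-- with general symmetries σ m n : m + n → n + m.
-- Composition _⨾_ is diagrammatic (f ⨾ g = "first f, then g").
data Circ : ℕ → ℕ → Set where
  idc  : (n : ℕ) → Circ n n
  _⨾_  : ∀ {a b c} → Circ a b → Circ b c → Circ a c
  _⊗_  : ∀ {a b c d} → Circ a b → Circ c d → Circ (a + c) (b + d)
  σ    : (m n : ℕ) → Circ (m + n) (n + m)
  cnot : Circ 2 2
  ket1 : Circ 0 1
  bra1 : Circ 1 0

cast : ∀ {a b a' b'} → a ≡ a' → b ≡ b' → Circ a b → Circ a' b'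
cast p q f = subst₂ Circ p q f

-- named cnot gates:  C i j = control wire i, target wire j
C12 : Circ 2 2
C12 = cnot

C21 : Circ 2 2
C21 = σ 1 1 ⨾ cnot ⨾ σ 1 1

C12₃ C21₃ C23₃ C32₃ C13₃ : Circ 3 3
C12₃ = cnot ⊗ idc 1
C21₃ = C21 ⊗ idc 1
C23₃ = idc 1 ⊗ cnot
C32₃ = idc 1 ⊗ C21
C13₃ = (idc 1 ⊗ σ 1 1) ⨾ (cnot ⊗ idc 1) ⨾ (idc 1 ⊗ σ 1 1)

-- It is stated
-- heterogeneously (its two sides may have propositionally, not
-- definitionally, equal types); every rule relates morphisms whose
-- domains and codomains are equal.
infix 4 _≈_
data _≈_ : ∀ {a b c d} → Circ a b → Circ c d → Set where
  ≈-refl  : ∀ {a b} {f : Circ a b} → f ≈ f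
  ≈-sym   : ∀ {a b c d} {f : Circ a b} {g : Circ c d} → f ≈ g → g ≈ f
  ≈-trans : ∀ {a b c d e k} {f : Circ a b} {g : Circ c d} {h : Circ e k} →
            f ≈ g → g ≈ h → f ≈ h
  cast-id : ∀ {a b a' b'} (p : a ≡ a') (q : b ≡ b') (f : Circ a b) → cast p q f ≈ f
  ⨾-cong  : ∀ {a b c a' b' c'} {f : Circ a b} {g : Circ b c}
              {f' : Circ a' b'} {g' : Circ b' c'} →
            f ≈ f' → g ≈ g' → f ⨾ g ≈ f' ⨾ g'
  ⊗-cong  : ∀ {a b c d a' b' c' d'} {f : Circ a b} {g : Circ c d}
              {f' : Circ a' b'} {g' : Circ c' d'} →
            f ≈ f' → g ≈ g' → f ⊗ g ≈ f' ⊗ g'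
  idˡ     : ∀ {a b} (f : Circ a b) → idc a ⨾ f ≈ f
  idʳ     : ∀ {a b} (f : Circ a b) → f ⨾ idc b ≈ f
  ⨾-assoc : ∀ {a b c d} (f : Circ a b) (g : Circ b c) (h : Circ c d) →
            (f ⨾ g) ⨾ h ≈ f ⨾ (g ⨾ h)
  ⊗-assoc : ∀ {a b c d e k} (f : Circ a b) (g : Circ c d) (h : Circ e k) →
            (f ⊗ g) ⊗ h ≈ f ⊗ (g ⊗ h)
  ⊗-unitˡ : ∀ {a b} (f : Circ a b) → idc 0 ⊗ f ≈ f
  ⊗-unitʳ : ∀ {a b} (f : Circ a b) → f ⊗ idc 0 ≈ f
  ⊗-id    : (m n : ℕ) → idc m ⊗ idc n ≈ idc (m + n)
  interchange : ∀ {a b c d e k} (f : Circ a b) (g : Circ b c)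
                  (h : Circ d e) (l : Circ e k) →
                (f ⨾ g) ⊗ (h ⨾ l) ≈ (f ⊗ h) ⨾ (g ⊗ l)
  σ-nat   : ∀ {a b c d} (f : Circ a b) (g : Circ c d) →
            (f ⊗ g) ⨾ σ b d ≈ σ a c ⨾ (g ⊗ f)
  σ-inv   : (m n : ℕ) → σ m n ⨾ σ n m ≈ idc (m + n)
  σ-hex   : (m n k : ℕ) →
            σ m (n + k) ≈
            (σ m n ⊗ idc k) ⨾ cast (sym (+-assoc n m k)) refl (idc n ⊗ σ m k)
  ax1  : cnot ⨾ C21 ⨾ cnot ≈ σ 1 1
  ax2  : cnot ⨾ cnot ≈ idc 2
  ax3  : C21₃ ⨾ C23₃ ≈ C23₃ ⨾ C21₃
  ax4a : (ket1 ⊗ idc 1) ⨾ cnot ≈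
         (ket1 ⊗ idc 1) ⨾ cnot ⨾ (bra1 ⊗ idc 1) ⨾ (ket1 ⊗ idc 1)
  ax4b : cnot ⨾ (bra1 ⊗ idc 1) ≈
         (bra1 ⊗ idc 1) ⨾ (ket1 ⊗ idc 1) ⨾ cnot ⨾ (bra1 ⊗ idc 1)
  ax5  : C12₃ ⨾ C32₃ ≈ C32₃ ⨾ C12₃
  ax6  : ket1 ⨾ bra1 ≈ idc 0
  ax7a : (ket1 ⊗ ket1 ⊗ idc 1) ⨾ C12₃ ⨾ C23₃ ⨾ (bra1 ⊗ idc 2) ≈
         (ket1 ⊗ ket1 ⊗ idc 1) ⨾ C12₃ ⨾ (bra1 ⊗ idc 2)
  ax7b : (ket1 ⊗ idc 2) ⨾ C23₃ ⨾ C12₃ ⨾ (bra1 ⊗ bra1 ⊗ idc 1) ≈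
         (ket1 ⊗ idc 2) ⨾ C12₃ ⨾ (bra1 ⊗ bra1 ⊗ idc 1)
  ax8  : C12₃ ⨾ C23₃ ⨾ C12₃ ≈ C23₃ ⨾ C13₃
  ax9  : (ket1 ⊗ ket1 ⊗ idc 1) ⨾ C12₃ ⨾ (bra1 ⊗ bra1 ⊗ idc 1) ≈
         (ket1 ⊗ ket1 ⊗ bra1) ⨾ cnot ⨾ (bra1 ⊗ bra1 ⊗ ket1)

flip : ∀ {a b} → Circ a b → Circ b a
flip (idc n) = idc n
flip (f ⨾ g) = flip g ⨾ flip f
flip (f ⊗ g) = flip f ⊗ flip g
flip (σ m n) = σ n m
flip cnot    = cnot
flip ket1    = bra1
flip bra1    = ket1

ket0 : Circ 0 1
ket0 = (ket1 ⊗ ket1) ⨾ cnot ⨾ (bra1 ⊗ idc 1)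

Δ₁ : Circ 1 2
Δ₁ = (ket0 ⊗ idc 1) ⨾ C21

-- Δ (suc (suc k)) = (Δ (suc k) ⊗ Δ₁) ⨾ (1_{k+1} ⊗ s ⊗ 1₁),
-- s = σ (k+1) 1 : (k+1)+1 → 1+(k+1); casts only fix index arithmetic.
Δ : (n : ℕ) → Circ n (n + n)
Δ zero = idc 0
Δ (suc zero) = Δ₁
Δ (suc (suc k)) =
  cast (+-comm (suc k) 1) eq
    ((Δ (suc k) ⊗ Δ₁) ⨾
     cast eq' refl ((idc (suc k) ⊗ σ (suc k) 1) ⊗ idc 1))
  where
    eq' : (suc k + (suc k + 1)) + 1 ≡ (suc k + suc k) + 2
    eq' = trans (+-assoc (suc k) (suc k + 1) 1)
           (trans (cong (suc k +_) (+-assoc (suc k) 1 1))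
             (sym (+-assoc (suc k) (suc k) 2)))
    eq : (suc k + (1 + suc k)) + 1 ≡ suc (suc k) + suc (suc k)
    eq = +-comm (suc k + suc (suc k)) 1

∇ : (n : ℕ) → Circ (n + n) n
∇ n = flip (Δ n)

-- The horizontal flip behaves as a dagger, and f ⨾ f° ≈ 1 says that f is an
-- isometry. Isometries are closed under composition, tensor and symmetries,
-- and cnot (being self-inverse) and |1⟩ (by |1⟩⟨1| = 1₀) are isometries.
-- The one non-isometric piece, ⟨1| in |0⟩, is absorbed: after (|1⟩ ⊗ 1)cnot the
-- projector (⟨1| ⊗ 1)(|1⟩ ⊗ 1) acts as the identity. Hence |0⟩, Δ₁ and, by
-- induction along its definition, every Δₙ is an isometry.
module Submission where

open import Defs
open import Data.Nat using (ℕ; zero; suc; _+_)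
open import Relation.Binary.PropositionalEquality using (_≡_; refl)

module ≈-Reasoning where

  infix  1 begin_
  infixr 2 _≈⟨_⟩_
  infix  3 _∎

  begin_ : ∀ {a b c d} {f : Circ a b} {g : Circ c d} → f ≈ g → f ≈ g
  begin p = p

  _≈⟨_⟩_ : ∀ {a b c d e k} (f : Circ a b) {g : Circ c d} {h : Circ e k} →
           f ≈ g → g ≈ h → f ≈ h
  f ≈⟨ p ⟩ q = ≈-trans p q

  _∎ : ∀ {a b} (f : Circ a b) → f ≈ f
  f ∎ = ≈-refl

open ≈-Reasoning

Isometry : ∀ {a b} → Circ a b → Set
Isometry {a} f = f ⨾ flip f ≈ idc a

isometry-idc : (n : ℕ) → Isometry (idc n)
isometry-idc n = idˡ (idc n)

isometry-σ : (m n : ℕ) → Isometry (σ m n)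
isometry-σ = σ-inv

isometry-cnot : Isometry cnot
isometry-cnot = ax2

isometry-ket1 : Isometry ket1
isometry-ket1 = ax6

isometry-cast : ∀ {a b a' b'} (p : a ≡ a') (q : b ≡ b') {f : Circ a b} →
                Isometry f → Isometry (cast p q f)
isometry-cast refl refl iso = iso

isometry-⨾-absorb : ∀ {a b c} {f : Circ a b} {g : Circ b c} →
                    f ⨾ (g ⨾ flip g) ≈ f → Isometry f → Isometry (f ⨾ g)
isometry-⨾-absorb {a} {f = f} {g} absorb iso = begin
  (f ⨾ g) ⨾ (flip g ⨾ flip f)  ≈⟨ ⨾-assoc f g _ ⟩
  f ⨾ (g ⨾ (flip g ⨾ flip f))  ≈⟨ ⨾-cong ≈-refl (≈-sym (⨾-assoc g (flip g) (flip f))) ⟩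
  f ⨾ ((g ⨾ flip g) ⨾ flip f)  ≈⟨ ≈-sym (⨾-assoc f _ (flip f)) ⟩
  (f ⨾ (g ⨾ flip g)) ⨾ flip f  ≈⟨ ⨾-cong absorb ≈-refl ⟩
  f ⨾ flip f                   ≈⟨ iso ⟩
  idc a                        ∎

isometry-⨾ : ∀ {a b c} {f : Circ a b} {g : Circ b c} →
             Isometry f → Isometry g → Isometry (f ⨾ g)
isometry-⨾ {f = f} isoF isoG =
  isometry-⨾-absorb (≈-trans (⨾-cong ≈-refl isoG) (idʳ f)) isoF

isometry-⊗ : ∀ {a b c d} {f : Circ a b} {g : Circ c d} →
             Isometry f → Isometry g → Isometry (f ⊗ g)
isometry-⊗ {a} {c = c} {f = f} {g} isoF isoG = begin
  (f ⊗ g) ⨾ (flip f ⊗ flip g)      ≈⟨ ≈-sym (interchange f (flip f) g (flip g)) ⟩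
  (f ⨾ flip f) ⊗ (g ⨾ flip g)      ≈⟨ ⊗-cong isoF isoG ⟩
  idc a ⊗ idc c                    ≈⟨ ⊗-id a c ⟩
  idc (a + c)                      ∎

state⊗≈⨾ : ∀ {b c d} (s : Circ 0 b) (g : Circ c d) → s ⊗ g ≈ g ⨾ (s ⊗ idc d)
state⊗≈⨾ {d = d} s g = begin
  s ⊗ g                          ≈⟨ ⊗-cong (≈-sym (idˡ s)) (≈-sym (idʳ g)) ⟩
  (idc 0 ⨾ s) ⊗ (g ⨾ idc d)      ≈⟨ interchange (idc 0) s g (idc d) ⟩
  (idc 0 ⊗ g) ⨾ (s ⊗ idc d)      ≈⟨ ⨾-cong (⊗-unitˡ g) ≈-refl ⟩
  g ⨾ (s ⊗ idc d)                ∎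

isometry-ket0 : Isometry ket0
isometry-ket0 = isometry-⨾-absorb absorb
  (isometry-⨾ (isometry-⊗ isometry-ket1 isometry-ket1) isometry-cnot)
  where
  K = ket1 ⊗ idc 1
  B = bra1 ⊗ idc 1
  absorb : ((ket1 ⊗ ket1) ⨾ cnot) ⨾ (B ⨾ K) ≈ (ket1 ⊗ ket1) ⨾ cnot
  absorb = begin
    ((ket1 ⊗ ket1) ⨾ cnot) ⨾ (B ⨾ K)  ≈⟨ ⨾-cong (⨾-cong (state⊗≈⨾ ket1 ket1) ≈-refl) ≈-refl ⟩
    ((ket1 ⨾ K) ⨾ cnot) ⨾ (B ⨾ K)     ≈⟨ ⨾-cong (⨾-assoc ket1 K cnot) ≈-refl ⟩
    (ket1 ⨾ (K ⨾ cnot)) ⨾ (B ⨾ K)     ≈⟨ ⨾-assoc ket1 (K ⨾ cnot) (B ⨾ K) ⟩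
    ket1 ⨾ ((K ⨾ cnot) ⨾ (B ⨾ K))     ≈⟨ ⨾-cong ≈-refl (≈-sym (⨾-assoc (K ⨾ cnot) B K)) ⟩
    ket1 ⨾ (((K ⨾ cnot) ⨾ B) ⨾ K)     ≈⟨ ⨾-cong ≈-refl (≈-sym ax4a) ⟩
    ket1 ⨾ (K ⨾ cnot)                 ≈⟨ ≈-sym (⨾-assoc ket1 K cnot) ⟩
    (ket1 ⨾ K) ⨾ cnot                 ≈⟨ ⨾-cong (≈-sym (state⊗≈⨾ ket1 ket1)) ≈-refl ⟩
    (ket1 ⊗ ket1) ⨾ cnot              ∎

isometry-C21 : Isometry C21
isometry-C21 = isometry-⨾ (isometry-⨾ (isometry-σ 1 1) isometry-cnot) (isometry-σ 1 1)

isometry-Δ₁ : Isometry Δ₁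
isometry-Δ₁ = isometry-⨾ (isometry-⊗ isometry-ket0 (isometry-idc 1)) isometry-C21

isometry-Δ : (n : ℕ) → Isometry (Δ n)
isometry-Δ zero          = isometry-idc 0
isometry-Δ (suc zero)    = isometry-Δ₁
isometry-Δ (suc (suc k)) =
  isometry-cast _ _
    (isometry-⨾ (isometry-⊗ (isometry-Δ (suc k)) isometry-Δ₁)
      (isometry-cast _ refl
        (isometry-⊗ (isometry-⊗ (isometry-idc (suc k)) (isometry-σ (suc k) 1))
                    (isometry-idc 1))))

mainTheorem17 : (n : ℕ) → Δ n ⨾ ∇ n ≈ idc n
mainTheorem17 = isometry-Δ
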